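{- Suppose $\sigma$ occurs as a consecutive pattern in $\tau$ but that the first two letters of $\tau$ (or the last two letters of $\tau$) are not involved in any occurrence of $\sigma$. Then $\mu(\sigma,\tau)=0$.
   Context: Permutations are of $[d]=\{1,\dots,d\}$. An occurrence of a consecutive pattern $\sigma$ in $\tau$ is a factor of consecutive letters of $\tau$ whose letters appear in the same relative order of size as those of $\sigma$. Permutations are partially ordered by $\sigma\le\tau$ iff $\sigma$ occurs as a consecutive pattern in $\tau$; $\mu$ is the Möbius function of this poset ($\mu(x,x)=1$, $\mu(x,y)=-\sum_{x\le z<y}\mu(x,z)$ for $x<y$). -}

module Defs where

open import Data.Nat using (ℕ; zero; suc; _+_; _∸_; _≤_; _<_)
open import Data.Integer using (ℤ; -_; +_)
open import Data.List using (List; []; _∷_; length; map; upTo; foldr)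
import Data.Integer as ℤ
open import Data.List.Relation.Binary.Permutation.Propositional using (_↭_)
open import Data.List.Relation.Unary.Unique.Propositional using (Unique)
open import Data.List.Membership.Propositional using (_∈_)
open import Data.Product using (_×_; ∃)
open import Function.Bundles using (_⇔_)
open import Relation.Binary.PropositionalEquality using (_≡_)
open import Relation.Nullary using (¬_)

-- A permutation is written in one-line notation as a list of naturals.
-- IsPerm p : p is a permutation of [d] = {1,…,d} where d = length p ≥ 1.
IsPerm : List ℕ → Set
IsPerm p = 1 ≤ length p × (p ↭ map suc (upTo (length p)))

-- j-th letter (0-based); the default 0 is only ever used out of bounds,
-- and all uses below are within bounds.
_‼_ : List ℕ → ℕ → ℕ
[] ‼ _ = 0
(x ∷ xs) ‼ zero = x
(x ∷ xs) ‼ suc j = xs ‼ j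

OccAt : List ℕ → List ℕ → ℕ → Set
OccAt σ τ i =
  (i + length σ ≤ length τ) ×
  (∀ j k → j < length σ → k < length σ →
     (σ ‼ j < σ ‼ k) ⇔ (τ ‼ (i + j) < τ ‼ (i + k)))

Involved : List ℕ → ℕ → ℕ → Set
Involved σ i p = (i ≤ p) × (p < i + length σ)

_≼_ : List ℕ → List ℕ → Set
σ ≼ τ = ∃ λ i → OccAt σ τ i

sumℤ : List ℤ → ℤ
sumℤ = foldr ℤ._+_ (+ 0)

EnumHalfOpen : List ℕ → List ℕ → List (List ℕ) → Set
EnumHalfOpen x y L =
  Unique L × (∀ z → (z ∈ L) ⇔ (IsPerm z × x ≼ z × z ≼ y × ¬ (z ≡ y)))

-- m is the Möbius function of the consecutive pattern poset:
--   m(x,x) = 1,  m(x,y) = - Σ_{x ≤ z < y} m(x,z)  for x < y.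
-- (The finite sum is over any duplicate-free enumeration of the interval.)
IsMobius : (List ℕ → List ℕ → ℤ) → Set
IsMobius m =
  (∀ x → IsPerm x → m x x ≡ + 1) ×
  (∀ x y L → IsPerm x → IsPerm y → x ≼ y → ¬ (x ≡ y) →
     EnumHalfOpen x y L → m x y ≡ - sumℤ (map (m x) L))

module Submission where

-- Idea (first-two case; the last-two case is its mirror image).  Let a be τ with
-- its first letter deleted and standardized, so a occurs in τ at position 1 and
-- |a| = |τ| - 1.  Every occurrence of σ starts at position ≥ 2, so σ < a.  The
-- interval [σ, τ) splits into the closed interval [σ, a], whose μ-sum is 0 by the
-- defining recursion, and the patterns z not below a.  Such z must occur in τ only
-- at position 0 (otherwise z ≤ a), so z is a proper prefix of τ that again avoids
-- σ in its first two letters; by induction on |τ|, μ(σ, z) = 0.  Hence μ(σ, τ) = 0.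

open import Defs

open import Data.Nat using (ℕ; zero; suc; _+_; _∸_; _⊓_; _≤_; _<_; z≤n; s≤s; _≤?_; _<?_; _≟_; pred)
open import Data.Nat.Properties
  using (≤-refl; ≤-reflexive; ≤-trans; ≤-antisym; ≤-pred; <-≤-trans; ≤-<-trans; <-trans; <⇒≤; <⇒≱; ≤∧≢⇒<;
         ≮⇒≥; ≰⇒>; <-irrefl; n≤1+n; m≤m+n; m≤n+m; m<m+n; m<n+m; +-monoʳ-≤; +-monoʳ-<; +-assoc; +-suc;
         +-identityʳ; +-cancelˡ-≤; ∸-monoˡ-≤; suc-injective; pred-mono-≤; m≤n⇒m⊓n≡m; m≥n⇒m⊓n≡n; ⊓-zeroʳ;
         anyUpTo?; allUpTo?)
open import Data.Nat.Induction using (<-wellFounded)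
open import Data.Integer using (ℤ; +_; -_) renaming (_+_ to _+ℤ_)
import Data.Integer.Properties as ℤ
open import Data.List
  using (List; []; _∷_; _++_; [_]; map; filter; length; upTo; downFrom; concatMap; deduplicate; initLast; _∷ʳ′_)
open import Data.List.Properties using (≡-dec; length-map; length-++; reverse-upTo; filter-accept; filter-reject)
open import Data.List.Relation.Unary.All using (All; []; _∷_)
import Data.List.Relation.Unary.All as All
open import Data.List.Relation.Unary.AllPairs using (_∷_)
open import Data.List.Relation.Unary.Any using (here; there)
import Data.List.Relation.Unary.Any as Any
open import Data.List.Membership.Propositional using (_∈_)
open import Data.List.Membership.Propositional.Properties
  using (∈-∃++; ∈-map⁺; ∈-map⁻; ∈-upTo⁺; ∈-applyDownFrom⁻; ∈-concatMap⁺; ∈-filter⁺; ∈-filter⁻;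
         ∈-deduplicate⁺; ∈-deduplicate⁻)
open import Data.List.Membership.Propositional.Properties.WithK using (unique∧set⇒bag)
open import Data.List.Membership.DecPropositional _≟_ using (_∈?_)
open import Data.List.Relation.Unary.Unique.Propositional using (Unique)
import Data.List.Relation.Unary.Unique.Propositional.Properties as Unique
open import Data.List.Relation.Unary.Unique.DecPropositional.Properties (≡-dec _≟_) using (deduplicate-!)
open import Data.List.Relation.Binary.BagAndSetEquality using (∼bag⇒↭)
open import Data.List.Relation.Binary.Permutation.Propositional
  using (_↭_; ↭-refl; ↭-sym; ↭-trans; ↭-reflexive; ↭-prep; ↭-swap; ↭⇒↭ₛ)
open import Data.List.Relation.Binary.Permutation.Propositional.Properties
  using (map⁺; ↭-reverse; ∈-resp-↭; filter-↭; ↭-length; drop-∷; shift; ∷↭∷ʳ)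
import Data.List.Relation.Binary.Permutation.Setoid.Properties as ↭ₛ
open import Data.Product using (_×_; _,_; proj₁; proj₂; ∃)
open import Data.Sum using (_⊎_; inj₁; inj₂)
open import Function.Base using (_∘_)
open import Function.Bundles using (_⇔_; mk⇔; Equivalence)
open import Function.Construct.Composition using (_⇔-∘_)
open import Function.Construct.Symmetry using (⇔-sym)
open import Function.Construct.Identity using (⇔-id)
open import Induction.WellFounded using (Acc; acc)
open import Level using (0ℓ)
open import Relation.Nullary using (¬_; Dec; yes; no; ¬?; contradiction)
open import Relation.Nullary.Decidable using (_×-dec_; _→-dec_; map′)
open import Relation.Unary using (Pred; Decidable)
open import Relation.Binary.PropositionalEquality
  using (_≡_; _≢_; refl; sym; trans; cong; cong₂; subst; subst₂; setoid; module ≡-Reasoning)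

sumℤ-↭ : {xs ys : List ℤ} → xs ↭ ys → sumℤ xs ≡ sumℤ ys
sumℤ-↭ p = ↭ₛ.foldr-commMonoid (setoid ℤ) ℤ.+-0-isCommutativeMonoid (↭⇒↭ₛ p)

sumℤ-partition : {A : Set} (f : A → ℤ) {P : Pred A 0ℓ} (P? : Decidable P) (L : List A) →
  sumℤ (map f L) ≡ sumℤ (map f (filter P? L)) +ℤ sumℤ (map f (filter (¬? ∘ P?) L))
sumℤ-partition f P? [] = refl
sumℤ-partition f P? (x ∷ L) with P? x
... | yes _ = trans (cong (f x +ℤ_) (sumℤ-partition f P? L)) (sym (ℤ.+-assoc (f x) _ _))
... | no _ = begin
    f x +ℤ sumℤ (map f L)   ≡⟨ cong (f x +ℤ_) (sumℤ-partition f P? L) ⟩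
    f x +ℤ (s +ℤ t)        ≡⟨ sym (ℤ.+-assoc (f x) s t) ⟩
    (f x +ℤ s) +ℤ t        ≡⟨ cong (_+ℤ t) (ℤ.+-comm (f x) s) ⟩
    (s +ℤ f x) +ℤ t        ≡⟨ ℤ.+-assoc s (f x) t ⟩
    s +ℤ (f x +ℤ t)        ∎
  where
  open ≡-Reasoning
  s = sumℤ (map f (filter P? L))
  t = sumℤ (map f (filter (¬? ∘ P?) L))

sumℤ-vanishing : {A : Set} (f : A → ℤ) (L : List A) → All (λ z → f z ≡ + 0) L → sumℤ (map f L) ≡ + 0
sumℤ-vanishing f [] [] = refl
sumℤ-vanishing f (x ∷ L) (fx≡0 ∷ rest) = cong₂ _+ℤ_ fx≡0 (sumℤ-vanishing f L rest)

-- [d, d-1, …, 1]: the letters of a permutation of [d], listed in the order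
-- best suited to induction on d.
descending : ℕ → List ℕ
descending n = map suc (downFrom n)

descending-letter : ∀ {n x} → x ∈ descending n → ∃ λ v → x ≡ suc v × v < n
descending-letter x∈ with ∈-map⁻ suc x∈
... | v , v∈ , refl with ∈-applyDownFrom⁻ (λ i → i) v∈
... | _ , v<n , refl = v , refl , v<n

descending-unique : ∀ n → Unique (descending n)
descending-unique n = Unique.map⁺ suc-injective (Unique.downFrom⁺ n)

ascending↭descending : ∀ n → map suc (upTo n) ↭ descending n
ascending↭descending n = map⁺ suc (↭-trans (↭-sym (↭-reverse (upTo n))) (↭-reflexive (reverse-upTo n)))

perm↭descending : ∀ {p} → IsPerm p → p ↭ descending (length p)
perm↭descending (_ , p↭) = ↭-trans p↭ (ascending↭descending _)

descending⇒perm : ∀ {p} → 1 ≤ length p → p ↭ descending (length p) → IsPerm p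
descending⇒perm 1≤|p| p↭ = 1≤|p| , ↭-trans p↭ (↭-sym (ascending↭descending _))

perm-letter : ∀ {p x} → IsPerm p → x ∈ p → ∃ λ v → x ≡ suc v × v < length p
perm-letter isP x∈ = descending-letter (∈-resp-↭ (perm↭descending isP) x∈)

letter≤length : ∀ {p v} → IsPerm p → v ∈ p → v ≤ length p
letter≤length isP v∈ with perm-letter isP v∈
... | _ , refl , u<|p| = u<|p|

‼-∈ : ∀ xs {j} → j < length xs → xs ‼ j ∈ xs
‼-∈ (x ∷ xs) {zero} _ = here refl
‼-∈ (x ∷ xs) {suc j} (s≤s j<) = there (‼-∈ xs j<)

‼-ext : ∀ p q → length p ≡ length q → (∀ j → j < length p → p ‼ j ≡ q ‼ j) → p ≡ q
‼-ext [] [] _ _ = refl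
‼-ext (x ∷ p) (y ∷ q) len eq =
  cong₂ _∷_ (eq 0 (s≤s z≤n)) (‼-ext p q (suc-injective len) (λ j j< → eq (suc j) (s≤s j<)))

‼-++ : ∀ xs ys {j} → j < length xs → (xs ++ ys) ‼ j ≡ xs ‼ j
‼-++ (x ∷ xs) ys {zero} _ = refl
‼-++ (x ∷ xs) ys {suc j} (s≤s j<) = ‼-++ xs ys j<

map-‼ : ∀ (f : ℕ → ℕ) xs {j} → j < length xs → map f xs ‼ j ≡ f (xs ‼ j)
map-‼ f (x ∷ xs) {zero} _ = refl
map-‼ f (x ∷ xs) {suc j} (s≤s j<) = map-‼ f xs j<

occ-refl : ∀ a → OccAt a a 0
occ-refl a = ≤-refl , λ j k _ _ → ⇔-id _

occ-trans : ∀ {z a τ j i} → OccAt z a j → OccAt a τ i → OccAt z τ (i + j)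
occ-trans {z} {a} {τ} {j} {i} (za-fits , za-order) (aτ-fits , aτ-order) = fits , order
  where
  inside : ∀ {x} → x < length z → j + x < length a
  inside x< = <-≤-trans (+-monoʳ-< j x<) za-fits
  fits : i + j + length z ≤ length τ
  fits = subst (_≤ length τ) (sym (+-assoc i j (length z))) (≤-trans (+-monoʳ-≤ i za-fits) aτ-fits)
  order : ∀ x y → x < length z → y < length z → (z ‼ x < z ‼ y) ⇔ (τ ‼ (i + j + x) < τ ‼ (i + j + y))
  order x y x< y< =
    subst₂ (λ u v → (a ‼ (j + x) < a ‼ (j + y)) ⇔ (τ ‼ u < τ ‼ v))
           (sym (+-assoc i j x)) (sym (+-assoc i j y)) (aτ-order _ _ (inside x<) (inside y<))
    ⇔-∘ za-order x y x< y<

occ-restrict : ∀ {z a τ m d} → OccAt a τ m → OccAt z τ (m + d) → d + length z ≤ length a → OccAt z a d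
occ-restrict {z} {a} {τ} {m} {d} (_ , aτ-order) (_ , zτ-order) fits = fits , order
  where
  inside : ∀ {x} → x < length z → d + x < length a
  inside x< = <-≤-trans (+-monoʳ-< d x<) fits
  order : ∀ x y → x < length z → y < length z → (z ‼ x < z ‼ y) ⇔ (a ‼ (d + x) < a ‼ (d + y))
  order x y x< y< =
    ⇔-sym (aτ-order _ _ (inside x<) (inside y<))
    ⇔-∘ subst₂ (λ u v → (z ‼ x < z ‼ y) ⇔ (τ ‼ u < τ ‼ v))
               (+-assoc m d x) (+-assoc m d y) (zτ-order x y x< y<)

occ-cons : ∀ {σ τ i} x → OccAt σ τ i → OccAt σ (x ∷ τ) (suc i)
occ-cons x (fits , order) = s≤s fits , order

prefix-occ : ∀ xs ys → OccAt xs (xs ++ ys) 0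
prefix-occ xs ys = fits , order
  where
  fits : length xs ≤ length (xs ++ ys)
  fits = subst (length xs ≤_) (sym (length-++ xs)) (m≤m+n _ _)
  order : ∀ j k → j < length xs → k < length xs → (xs ‼ j < xs ‼ k) ⇔ ((xs ++ ys) ‼ j < (xs ++ ys) ‼ k)
  order j k j< k< = subst₂ (λ u v → (xs ‼ j < xs ‼ k) ⇔ (u < v)) (sym (‼-++ xs ys j<)) (sym (‼-++ xs ys k<)) (⇔-id _)

≼-trans : ∀ {z a τ} → z ≼ a → a ≼ τ → z ≼ τ
≼-trans {z} {a} {τ} (j , za) (i , aτ) = i + j , occ-trans {z = z} {a = a} {τ = τ} za aτ

≼-length : ∀ {σ τ} → σ ≼ τ → length σ ≤ length τ
≼-length {σ} (i , fits , _) = ≤-trans (m≤n+m (length σ) i) fits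

shorter-than : ∀ {z a τ} → length a < length τ → z ≼ a → z ≢ τ
shorter-than {z} {a} a<τ z≼a refl = <-irrefl refl (<-≤-trans a<τ (≼-length {z} {a} z≼a))

rank : ℕ → List ℕ → ℕ
rank v xs = length (filter (_<? v) xs)

rank-↭ : ∀ v {xs ys} → xs ↭ ys → rank v xs ≡ rank v ys
rank-↭ v p = ↭-length (filter-↭ (_<? v) p)

rank-cons-< : ∀ {v x} xs → x < v → rank v (x ∷ xs) ≡ suc (rank v xs)
rank-cons-< {v} _ x<v = cong length (filter-accept (_<? v) x<v)

rank-cons-≮ : ∀ {v x} xs → ¬ x < v → rank v (x ∷ xs) ≡ rank v xs
rank-cons-≮ {v} _ x≮v = cong length (filter-reject (_<? v) x≮v)

rank-descending : ∀ v n → rank (suc v) (descending n) ≡ v ⊓ n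
rank-descending v zero = sym (⊓-zeroʳ v)
rank-descending v (suc n) with suc n <? suc v
... | yes 1+n<1+v@(s≤s n<v) = begin
  rank (suc v) (descending (suc n))  ≡⟨ rank-cons-< (descending n) 1+n<1+v ⟩
  suc (rank (suc v) (descending n))  ≡⟨ cong suc (rank-descending v n) ⟩
  suc (v ⊓ n)                        ≡⟨ cong suc (m≥n⇒m⊓n≡n (<⇒≤ n<v)) ⟩
  suc n                              ≡⟨ sym (m≥n⇒m⊓n≡n n<v) ⟩
  v ⊓ suc n                          ∎
  where open ≡-Reasoning
... | no n≮v = begin
  rank (suc v) (descending (suc n))  ≡⟨ rank-cons-≮ (descending n) n≮v ⟩
  rank (suc v) (descending n)        ≡⟨ rank-descending v n ⟩
  v ⊓ n                              ≡⟨ m≤n⇒m⊓n≡m v≤n ⟩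
  v                                  ≡⟨ sym (m≤n⇒m⊓n≡m (≤-trans v≤n (n≤1+n n))) ⟩
  v ⊓ suc n                          ∎
  where
  open ≡-Reasoning
  v≤n : v ≤ n
  v≤n = ≤-pred (≮⇒≥ n≮v)

rank-transfer : ∀ p q u w → length p ≡ length q → (∀ k → k < length p → (p ‼ k < u ⇔ q ‼ k < w)) →
  rank u p ≡ rank w q
rank-transfer [] [] u w _ _ = refl
rank-transfer (x ∷ p) (y ∷ q) u w len same
  with x <? u | y <? w | rank-transfer p q u w (suc-injective len) (λ k k< → same (suc k) (s≤s k<))
... | yes x<u | yes y<w | tail≡ = trans (rank-cons-< p x<u) (trans (cong suc tail≡) (sym (rank-cons-< q y<w)))
... | no x≮u  | no y≮w  | tail≡ = trans (rank-cons-≮ p x≮u) (trans tail≡ (sym (rank-cons-≮ q y≮w)))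
... | yes x<u | no y≮w  | _ = contradiction (Equivalence.to (same 0 (s≤s z≤n)) x<u) y≮w
... | no x≮u  | yes y<w | _ = contradiction (Equivalence.from (same 0 (s≤s z≤n)) y<w) x≮u

letter≡1+rank : ∀ {p x} → IsPerm p → x ∈ p → x ≡ suc (rank x p)
letter≡1+rank {p} isP x∈ with perm-letter isP x∈
... | v , refl , v<n = cong suc (begin
  v                                   ≡⟨ sym (m≤n⇒m⊓n≡m (<⇒≤ v<n)) ⟩
  v ⊓ length p                        ≡⟨ sym (rank-descending v (length p)) ⟩
  rank (suc v) (descending (length p)) ≡⟨ sym (rank-↭ (suc v) (perm↭descending isP)) ⟩
  rank (suc v) p                      ∎)
  where open ≡-Reasoning

perm-rigid : ∀ {p q} → IsPerm p → IsPerm q → length p ≡ length q →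
  (∀ j k → j < length p → k < length p → (p ‼ j < p ‼ k ⇔ q ‼ j < q ‼ k)) → p ≡ q
perm-rigid {p} {q} isP isQ len order = ‼-ext p q len same-letter
  where
  same-letter : ∀ j → j < length p → p ‼ j ≡ q ‼ j
  same-letter j j< = begin
    p ‼ j                       ≡⟨ letter≡1+rank isP (‼-∈ p j<) ⟩
    suc (rank (p ‼ j) p)        ≡⟨ cong suc (rank-transfer p q _ _ len (λ k k< → order k j k< j<)) ⟩
    suc (rank (q ‼ j) q)        ≡⟨ sym (letter≡1+rank isQ (‼-∈ q (subst (j <_) len j<))) ⟩
    q ‼ j                       ∎
    where open ≡-Reasoning

full-occ⇒≡ : ∀ {z τ} → IsPerm z → IsPerm τ → OccAt z τ 0 → length z ≡ length τ → z ≡ τ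
full-occ⇒≡ isZ isτ (_ , order) len = perm-rigid isZ isτ len order

-- close x v: the value of the letter v once the letter x has been removed from a
-- permutation and the gap above x is closed.
close : ℕ → ℕ → ℕ
close x v with x <? v
... | yes _ = pred v
... | no _ = v

close-above : ∀ {x v} → x < v → close x v ≡ pred v
close-above {x} {v} x<v with x <? v
... | yes _ = refl
... | no x≮v = contradiction x<v x≮v

close-below : ∀ {x v} → v ≤ x → close x v ≡ v
close-below {x} {v} v≤x with x <? v
... | yes x<v = contradiction v≤x (<⇒≱ x<v)
... | no _ = refl

close-order : ∀ x u v → u ≢ x → v ≢ x → (u < v ⇔ close x u < close x v)
close-order x u v _ _ with x <? u | x <? v
close-order x (suc u) (suc v) _ _ | yes (s≤s _) | yes (s≤s _) = mk⇔ (λ { (s≤s u<v) → u<v }) s≤s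
close-order x u v _ _ | no _ | no _ = ⇔-id _
close-order x (suc u) v _ _ | yes (s≤s x≤u) | no x≮v =
  mk⇔ (λ 1+u<v → contradiction (<-≤-trans (s≤s x≤u) (<⇒≤ 1+u<v)) x≮v)
      (λ u<v → contradiction (≤-<-trans x≤u u<v) x≮v)
close-order x u v u≢x _ | no x≮u | yes x<v =
  mk⇔ (λ _ → <-≤-trans u<x (pred-mono-≤ x<v)) (λ _ → <-trans u<x x<v)
  where
  u<x : u < x
  u<x = ≤∧≢⇒< (≮⇒≥ x≮u) u≢x

close-descending : ∀ {x} n → n ≤ x → map (close x) (descending n) ≡ descending n
close-descending zero _ = refl
close-descending (suc n) 1+n≤x = cong₂ _∷_ (close-below 1+n≤x) (close-descending n (≤-trans (n≤1+n n) 1+n≤x))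

-- Induction on n: either x is the largest
-- letter n+1, or n+1 survives, becomes n, and the rest is handled inductively.
delete-letter : ∀ n {x rest} → x ∷ rest ↭ descending (suc n) → map (close x) rest ↭ descending n
delete-letter n {x} {rest} p with x ≟ suc n
... | yes refl = ↭-trans (map⁺ (close x) (drop-∷ p)) (↭-reflexive (close-descending n (n≤1+n n)))
... | no x≢1+n with ∈-resp-↭ (↭-sym p) (here refl)
...   | here 1+n≡x = contradiction (sym 1+n≡x) x≢1+n
...   | there 1+n∈rest with ∈-∃++ 1+n∈rest
...     | l , r , refl = shrink n x<1+n rest-without-max
  where
  x<1+n : x < suc n
  x<1+n with descending-letter (∈-resp-↭ p (here refl))
  ... | v , refl , v<1+n = ≤∧≢⇒< v<1+n x≢1+n
  rest-without-max : x ∷ l ++ r ↭ descending n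
  rest-without-max = drop-∷ (↭-trans (↭-sym (↭-trans (↭-prep x (shift (suc n) l r)) (↭-swap x (suc n) ↭-refl))) p)
  shrink : ∀ m → x < suc m → x ∷ l ++ r ↭ descending m → map (close x) (l ++ [ suc m ] ++ r) ↭ descending m
  shrink zero _ q = contradiction (↭-length q) λ ()
  shrink (suc m) x<2+m q =
    ↭-trans (map⁺ (close x) (shift (suc (suc m)) l r))
      (↭-trans (↭-reflexive (cong (_∷ _) (close-above x<2+m))) (↭-prep (suc m) (delete-letter m q)))

head-fresh : ∀ {n x rest} → x ∷ rest ↭ descending n → ∀ {v} → v ∈ rest → v ≢ x
head-fresh {n} p v∈ with ↭ₛ.Unique-resp-↭ (setoid ℕ) (↭⇒↭ₛ (↭-sym p)) (descending-unique n)
... | x-fresh ∷ _ = λ v≡x → All.lookup x-fresh v∈ (sym v≡x)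

close-occ : ∀ {x rest} → (∀ {v} → v ∈ rest → v ≢ x) → OccAt (map (close x) rest) rest 0
close-occ {x} {rest} fresh = ≤-reflexive (length-map (close x) rest) , order
  where
  order : ∀ j k → j < length (map (close x) rest) → k < length (map (close x) rest) →
    (map (close x) rest ‼ j < map (close x) rest ‼ k) ⇔ (rest ‼ j < rest ‼ k)
  order j k j< k< =
    subst₂ (λ a b → (a < b) ⇔ (rest ‼ j < rest ‼ k))
           (sym (map-‼ (close x) rest j<′)) (sym (map-‼ (close x) rest k<′))
      (⇔-sym (close-order x _ _ (fresh (‼-∈ rest j<′)) (fresh (‼-∈ rest k<′))))
    where
    j<′ = subst (j <_) (length-map (close x) rest) j<
    k<′ = subst (k <_) (length-map (close x) rest) k<

-- A Shortening of τ at m: a permutation, one letter shorter than τ, occurring in τ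
-- at position m.  Deleting the first (m = 1) or last (m = 0) letter of τ and
-- standardizing gives one.
record Shortening (τ : List ℕ) (m : ℕ) : Set where
  field
    word        : List ℕ
    isPerm      : IsPerm word
    occurs      : OccAt word τ m
    one-shorter : suc (length word) ≡ length τ

standardize : ∀ {τ x rest m} → IsPerm τ → τ ↭ x ∷ rest → 1 ≤ length rest → OccAt rest τ m → Shortening τ m
standardize {τ} {x} {rest} {m} isτ τ↭ 1≤|rest| rest-occ = record
  { word        = closed
  ; isPerm      = descending⇒perm (subst (1 ≤_) (sym |word|≡) 1≤|rest|)
                                  (subst (λ n → closed ↭ descending n) (sym |word|≡) deleted)
  ; occurs      = subst (OccAt closed τ) (+-identityʳ m)
                    (occ-trans {z = closed} {a = rest} {τ = τ} {j = 0} {i = m} (close-occ (head-fresh x∷rest↭)) rest-occ)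
  ; one-shorter = trans (cong suc |word|≡) (sym |τ|≡)
  }
  where
  closed : List ℕ
  closed = map (close x) rest
  |word|≡ : length closed ≡ length rest
  |word|≡ = length-map (close x) rest
  |τ|≡ : length τ ≡ suc (length rest)
  |τ|≡ = ↭-length τ↭
  x∷rest↭ : x ∷ rest ↭ descending (suc (length rest))
  x∷rest↭ = subst (λ n → x ∷ rest ↭ descending n) |τ|≡ (↭-trans (↭-sym τ↭) (perm↭descending isτ))
  deleted : closed ↭ descending (length rest)
  deleted = delete-letter (length rest) x∷rest↭

shorten-first : ∀ {τ} → IsPerm τ → 2 ≤ length τ → Shortening τ 1
shorten-first {x ∷ rest} isτ (s≤s 1≤|rest|) =
  standardize isτ ↭-refl 1≤|rest| (occ-cons {σ = rest} {τ = rest} x (occ-refl rest))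

shorten-last : ∀ {τ} → IsPerm τ → 2 ≤ length τ → Shortening τ 0
shorten-last {τ} isτ 2≤ with initLast τ
shorten-last isτ (s≤s ()) | [] ∷ʳ′ x
... | rest@(_ ∷ _) ∷ʳ′ x = standardize {m = 0} isτ (↭-sym (∷↭∷ʳ x rest)) (s≤s z≤n) (prefix-occ rest [ x ])

_↭?_ : (xs ys : List ℕ) → Dec (xs ↭ ys)
[] ↭? [] = yes ↭-refl
[] ↭? (y ∷ ys) = no λ p → contradiction (↭-length p) λ ()
(x ∷ xs) ↭? ys with x ∈? ys
... | no x∉ys = no λ p → x∉ys (∈-resp-↭ p (here refl))
... | yes x∈ys with ∈-∃++ x∈ys
...   | l , r , refl with xs ↭? (l ++ r)
...     | yes q = yes (↭-trans (↭-prep x q) (↭-sym (shift x l r)))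
...     | no ¬q = no λ p → ¬q (drop-∷ (↭-trans p (shift x l r)))

isPerm? : ∀ p → Dec (IsPerm p)
isPerm? p = (1 ≤? length p) ×-dec (p ↭? map suc (upTo (length p)))

_⇔?_ : {A B : Set} → Dec A → Dec B → Dec (A ⇔ B)
a? ⇔? b? = map′ (λ (to , from) → mk⇔ to from) (λ e → Equivalence.to e , Equivalence.from e)
                ((a? →-dec b?) ×-dec (b? →-dec a?))

occAt? : ∀ σ τ i → Dec (OccAt σ τ i)
occAt? σ τ i = (i + length σ ≤? length τ) ×-dec
  map′ (λ ordered j k j< k< → ordered {j} j< {k} k<) (λ ordered {j} j< {k} k< → ordered j k j< k<)
       (allUpTo? (λ j → allUpTo? (λ k → (σ ‼ j <? σ ‼ k) ⇔? (τ ‼ (i + j) <? τ ‼ (i + k)))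
                                  (length σ))
                 (length σ))

-- An occurrence, if any, starts at a position ≤ |τ|.
_≼?_ : ∀ σ τ → Dec (σ ≼ τ)
σ ≼? τ = map′ (λ (i , _ , occ) → i , occ) (λ (i , occ) → i , s≤s (≤-trans (m≤m+n i _) (proj₁ occ)) , occ)
              (anyUpTo? (occAt? σ τ) (suc (length τ)))

words : ℕ → ℕ → List (List ℕ)
words B zero = [ [] ]
words B (suc n) = [] ∷ concatMap (λ x → map (x ∷_) (words B n)) (upTo (suc B))

∈-words : ∀ {B} n {w} → length w ≤ n → All (_≤ B) w → w ∈ words B n
∈-words zero {[]} _ _ = here refl
∈-words (suc n) {[]} _ _ = here refl
∈-words {B} (suc n) {x ∷ w} (s≤s |w|≤n) (x≤B ∷ w≤B) =
  there (∈-concatMap⁺ (λ y → map (y ∷_) (words B n))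
           (Any.map (λ { refl → ∈-map⁺ (x ∷_) (∈-words n |w|≤n w≤B) }) (∈-upTo⁺ (s≤s x≤B))))

_≟ₗ_ : (xs ys : List ℕ) → Dec (xs ≡ ys)
_≟ₗ_ = ≡-dec _≟_

InHalfOpen : List ℕ → List ℕ → List ℕ → Set
InHalfOpen x y z = IsPerm z × x ≼ z × z ≼ y × ¬ (z ≡ y)

inHalfOpen? : ∀ x y z → Dec (InHalfOpen x y z)
inHalfOpen? x y z = isPerm? z ×-dec (x ≼? z) ×-dec (z ≼? y) ×-dec ¬? (z ≟ₗ y)

enumerate : ∀ x y → ∃ λ L → EnumHalfOpen x y L
enumerate x y = L , deduplicate-! _ , λ z → mk⇔ sound complete
  where
  candidates : List (List ℕ)
  candidates = words (length y) (length y)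
  L : List (List ℕ)
  L = deduplicate _≟ₗ_ (filter (inHalfOpen? x y) candidates)
  sound : ∀ {z} → z ∈ L → InHalfOpen x y z
  sound z∈L = proj₂ (∈-filter⁻ (inHalfOpen? x y) {xs = candidates} (∈-deduplicate⁻ _≟ₗ_ _ z∈L))
  complete : ∀ {z} → InHalfOpen x y z → z ∈ L
  complete {z} inside@(isZ , _ , z≼y , _) = ∈-deduplicate⁺ _≟ₗ_ (∈-filter⁺ (inHalfOpen? x y) candidate inside)
    where
    |z|≤|y| : length z ≤ length y
    |z|≤|y| = ≼-length {z} {y} z≼y
    candidate : z ∈ candidates
    candidate = ∈-words _ |z|≤|y| (All.tabulate λ v∈ → ≤-trans (letter≤length isZ v∈) |z|≤|y|)

below-enumeration : ∀ {σ a τ Lτ La} → IsPerm a → σ ≼ a → a ≼ τ → length a < length τ →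
  EnumHalfOpen σ τ Lτ → EnumHalfOpen σ a La → filter (_≼? a) Lτ ↭ a ∷ La
below-enumeration {σ} {a} {τ} {Lτ} {La} isA σ≼a a≼τ a<τ (uniqueτ , memberτ) (uniqueA , memberA) =
  ∼bag⇒↭ (unique∧set⇒bag (Unique.filter⁺ (_≼? a) uniqueτ) (a-fresh ∷ uniqueA) (mk⇔ to from))
  where
  a-fresh : All (a ≢_) La
  a-fresh = All.tabulate λ z∈La a≡z → proj₂ (proj₂ (proj₂ (Equivalence.to (memberA _) z∈La))) (sym a≡z)
  to : ∀ {z} → z ∈ filter (_≼? a) Lτ → z ∈ a ∷ La
  to {z} z∈ with ∈-filter⁻ (_≼? a) {xs = Lτ} z∈ | z ≟ₗ a
  ... | _ | yes refl = here refl
  ... | z∈Lτ , z≼a | no z≢a with Equivalence.to (memberτ z) z∈Lτ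
  ...   | isZ , σ≼z , _ = there (Equivalence.from (memberA z) (isZ , σ≼z , z≼a , z≢a))
  from : ∀ {z} → z ∈ a ∷ La → z ∈ filter (_≼? a) Lτ
  from (here refl) =
    ∈-filter⁺ (_≼? a) (Equivalence.from (memberτ a) (isA , σ≼a , a≼τ , shorter-than {a} {a} a<τ a≼a)) a≼a
    where
    a≼a : a ≼ a
    a≼a = 0 , occ-refl a
  from {z} (there z∈La) with Equivalence.to (memberA z) z∈La
  ... | isZ , σ≼z , z≼a , _ =
    ∈-filter⁺ (_≼? a) (Equivalence.from (memberτ z)
      (isZ , σ≼z , ≼-trans {z} {a} {τ} z≼a a≼τ , shorter-than {z} {a} a<τ z≼a)) z≼a

shift-two : ∀ j k s → 2 + (j + k + s) ≡ j + (2 + (k + s))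
shift-two j k s =
  trans (cong (λ n → 2 + n) (+-assoc j k s)) (sym (trans (+-suc j (suc (k + s))) (cong suc (+-suc j (k + s)))))

module _ (μ : List ℕ → List ℕ → ℤ) (isMobius : IsMobius μ) where

  closed-interval-sum : ∀ {σ a L} → IsPerm σ → IsPerm a → σ ≼ a → σ ≢ a → EnumHalfOpen σ a L →
    μ σ a +ℤ sumℤ (map (μ σ) L) ≡ + 0
  closed-interval-sum {σ} {a} {L} isσ isA σ≼a σ≢a enum = begin
    μ σ a +ℤ S    ≡⟨ cong (_+ℤ S) (proj₂ isMobius σ a L isσ isA σ≼a σ≢a enum) ⟩
    - S +ℤ S      ≡⟨ ℤ.+-inverseˡ S ⟩
    + 0           ∎
    where
    open ≡-Reasoning
    S : ℤ
    S = sumℤ (map (μ σ) L)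

  -- Splitting lemma: if σ < a < τ with a shorter than τ, and μ(σ, z) = 0 for every z
  -- in [σ, τ) not below a, then μ(σ, τ) = 0, because the rest of [σ, τ) is [σ, a].
  vanish-above : ∀ {σ a τ} → IsPerm σ → IsPerm a → IsPerm τ → σ ≼ a → σ ≢ a → a ≼ τ → length a < length τ →
    (∀ z → InHalfOpen σ τ z → ¬ z ≼ a → μ σ z ≡ + 0) → μ σ τ ≡ + 0
  vanish-above {σ} {a} {τ} isσ isA isτ σ≼a σ≢a a≼τ a<τ outside-vanishes = begin
    μ σ τ                   ≡⟨ proj₂ isMobius σ τ Lτ isσ isτ σ≼τ σ≢τ enumτ ⟩
    - sumℤ (map (μ σ) Lτ)   ≡⟨ cong -_ (sumℤ-partition (μ σ) (_≼? a) Lτ) ⟩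
    - (Σbelow +ℤ Σoutside)  ≡⟨ cong₂ (λ s t → - (s +ℤ t)) below-vanishes outside-sum-vanishes ⟩
    + 0                     ∎
    where
    open ≡-Reasoning
    σ≼τ : σ ≼ τ
    σ≼τ = ≼-trans {σ} {a} {τ} σ≼a a≼τ
    σ≢τ : σ ≢ τ
    σ≢τ = shorter-than {σ} {a} a<τ σ≼a
    Lτ = proj₁ (enumerate σ τ)
    enumτ = proj₂ (enumerate σ τ)
    La = proj₁ (enumerate σ a)
    enumA = proj₂ (enumerate σ a)
    Σbelow = sumℤ (map (μ σ) (filter (_≼? a) Lτ))
    Σoutside = sumℤ (map (μ σ) (filter (¬? ∘ (_≼? a)) Lτ))
    outside : ∀ {z} → z ∈ filter (¬? ∘ (_≼? a)) Lτ → μ σ z ≡ + 0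
    outside z∈ with ∈-filter⁻ (¬? ∘ (_≼? a)) {xs = Lτ} z∈
    ... | z∈Lτ , z⋠a = outside-vanishes _ (Equivalence.to (proj₂ enumτ _) z∈Lτ) z⋠a
    outside-sum-vanishes : Σoutside ≡ + 0
    outside-sum-vanishes = sumℤ-vanishing (μ σ) _ (All.tabulate outside)
    below-vanishes : Σbelow ≡ + 0
    below-vanishes = trans (sumℤ-↭ (map⁺ (μ σ) (below-enumeration {σ} {a} {τ} isA σ≼a a≼τ a<τ enumτ enumA)))
                           (closed-interval-sum isσ isA σ≼a σ≢a enumA)

  -- First-two case, by well-founded induction on |τ|: split at a = τ minus its first
  -- letter; a pattern z ∈ [σ, τ) not below a occurs only at position 0, so it is a
  -- shorter word in which σ still avoids the first two positions.
  vanish-first : ∀ {σ τ} → Acc _<_ (length τ) → IsPerm σ → IsPerm τ → σ ≼ τ →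
    (∀ i → OccAt σ τ i → 2 ≤ i) → μ σ τ ≡ + 0
  vanish-first {σ} {τ} (acc smaller) isσ isτ (i , σ-at-i) late =
    vanish-above isσ isW isτ σ≼w σ≢w (1 , occurs) |w|<|τ| outside
    where
    2≤|τ| : 2 ≤ length τ
    2≤|τ| = ≤-trans (late i σ-at-i) (≤-trans (m≤m+n i (length σ)) (proj₁ σ-at-i))
    open Shortening (shorten-first isτ 2≤|τ|) renaming (word to w; isPerm to isW)
    |w|<|τ| : length w < length τ
    |w|<|τ| = ≤-reflexive one-shorter
    inside-w : ∀ z j → 1 ≤ j → OccAt z τ j → z ≼ w
    inside-w z (suc d) _ z-at = d , occ-restrict {z = z} {a = w} {τ = τ} {m = 1} {d = d} occurs z-at
                                        (≤-pred (subst (suc d + length z ≤_) (sym one-shorter) (proj₁ z-at)))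
    σ≼w : σ ≼ w
    σ≼w = inside-w σ i (≤-trans (s≤s z≤n) (late i σ-at-i)) σ-at-i
    σ≢w : σ ≢ w
    σ≢w σ≡w with late 1 (subst (λ v → OccAt v τ 1) (sym σ≡w) occurs)
    ... | s≤s ()
    outside : ∀ z → InHalfOpen σ τ z → ¬ z ≼ w → μ σ z ≡ + 0
    outside z (_ , _ , (suc j , z-at) , _) z⋠w = contradiction (inside-w z (suc j) (s≤s z≤n) z-at) z⋠w
    outside z (isZ , σ≼z , (zero , z-at) , z≢τ) _ =
      vanish-first (smaller |z|<|τ|) isσ isZ σ≼z (λ k σ-at-k → late k (occ-trans {σ} {z} {τ} σ-at-k z-at))
      where
      |z|<|τ| : length z < length τ
      |z|<|τ| = ≤∧≢⇒< (proj₁ z-at) (λ |z|≡|τ| → z≢τ (full-occ⇒≡ {z} {τ} isZ isτ z-at |z|≡|τ|))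

  -- Last-two case, symmetrically: split at a = τ minus its last letter; a pattern
  -- z ∈ [σ, τ) not below a is a proper suffix of τ in which σ still ends two letters early.
  vanish-last : ∀ {σ τ} → Acc _<_ (length τ) → IsPerm σ → IsPerm τ → σ ≼ τ →
    (∀ i → OccAt σ τ i → 2 + (i + length σ) ≤ length τ) → μ σ τ ≡ + 0
  vanish-last {σ} {τ} (acc smaller) isσ isτ (i , σ-at-i) early =
    vanish-above isσ isW isτ σ≼w σ≢w (0 , occurs) |w|<|τ| outside
    where
    2≤|τ| : 2 ≤ length τ
    2≤|τ| = ≤-trans (s≤s (s≤s z≤n)) (early i σ-at-i)
    open Shortening (shorten-last isτ 2≤|τ|) renaming (word to w; isPerm to isW)
    |w|<|τ| : length w < length τ
    |w|<|τ| = ≤-reflexive one-shorter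
    inside-w : ∀ z j → j + length z ≤ length w → OccAt z τ j → z ≼ w
    inside-w z j fits z-at = j , occ-restrict {z = z} {a = w} {τ = τ} {m = 0} {d = j} occurs z-at fits
    σ≼w : σ ≼ w
    σ≼w = inside-w σ i (≤-pred (≤-trans (n≤1+n _) room)) σ-at-i
      where
      room : 2 + (i + length σ) ≤ suc (length w)
      room = subst (2 + (i + length σ) ≤_) (sym one-shorter) (early i σ-at-i)
    σ≢w : σ ≢ w
    σ≢w σ≡w = <-irrefl refl (≤-pred (subst (2 + length σ ≤_) |τ|≡ (early 0 σ-at-0)))
      where
      σ-at-0 : OccAt σ τ 0
      σ-at-0 = subst (λ v → OccAt v τ 0) (sym σ≡w) occurs
      |τ|≡ : length τ ≡ suc (length σ)
      |τ|≡ = trans (sym one-shorter) (cong (suc ∘ length) (sym σ≡w))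
    ending : ∀ z j → IsPerm z → σ ≼ z → z ≢ τ → OccAt z τ j → j + length z ≡ length τ → μ σ z ≡ + 0
    ending z zero isZ _ z≢τ z-at |z|≡|τ| = contradiction (full-occ⇒≡ {z} {τ} isZ isτ z-at |z|≡|τ|) z≢τ
    ending z (suc j) isZ σ≼z _ z-at ends = vanish-last (smaller |z|<|τ|) isσ isZ σ≼z early-in-z
      where
      |z|<|τ| : length z < length τ
      |z|<|τ| = subst (length z <_) ends (m<n+m (length z) (s≤s z≤n))
      early-in-z : ∀ k → OccAt σ z k → 2 + (k + length σ) ≤ length z
      early-in-z k σ-at-k = +-cancelˡ-≤ (suc j) _ _ (subst₂ _≤_ (shift-two (suc j) k (length σ)) (sym ends)
                              (early (suc j + k) (occ-trans {σ} {z} {τ} σ-at-k z-at)))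
    outside : ∀ z → InHalfOpen σ τ z → ¬ z ≼ w → μ σ z ≡ + 0
    outside z (isZ , σ≼z , (j , z-at) , z≢τ) z⋠w with j + length z ≤? length w
    ... | yes fits = contradiction (inside-w z j fits z-at) z⋠w
    ... | no overhangs = ending z j isZ σ≼z z≢τ z-at
                           (≤-antisym (proj₁ z-at) (subst (_≤ j + length z) one-shorter (≰⇒> overhangs)))

involved-at-start : ∀ σ i → 1 ≤ length σ → Involved σ i i
involved-at-start σ i 1≤|σ| = ≤-refl , m<m+n i 1≤|σ|

first-two-free⇒late : ∀ {σ τ} → 1 ≤ length σ → (∀ i p → OccAt σ τ i → p < 2 → ¬ Involved σ i p) →
  ∀ i → OccAt σ τ i → 2 ≤ i
first-two-free⇒late {σ} 1≤|σ| free i σ-at-i with 2 ≤? i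
... | yes 2≤i = 2≤i
... | no 2≰i = contradiction (involved-at-start σ i 1≤|σ|) (free i i σ-at-i (≰⇒> 2≰i))

last-two-free⇒early : ∀ {σ τ} → IsPerm σ →
  (∀ i p → OccAt σ τ i → length τ ∸ 2 ≤ p → p < length τ → ¬ Involved σ i p) →
  ∀ i → OccAt σ τ i → 2 + (i + length σ) ≤ length τ
last-two-free⇒early {[]} (() , _)
last-two-free⇒early {x ∷ xs} {τ} _ free i σ-at-i with 2 + (i + length (x ∷ xs)) ≤? length τ
... | yes room = room
... | no no-room = contradiction involved (free i last σ-at-i near-end last<|τ|)
  where
  last : ℕ
  last = i + length xs
  end≡ : i + length (x ∷ xs) ≡ suc last
  end≡ = +-suc i (length xs)
  involved : Involved (x ∷ xs) i last
  involved = m≤m+n i (length xs) , subst (last <_) (sym end≡) ≤-refl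
  last<|τ| : last < length τ
  last<|τ| = subst (_≤ length τ) end≡ (proj₁ σ-at-i)
  near-end : length τ ∸ 2 ≤ last
  near-end = ∸-monoˡ-≤ 2 (≤-pred (subst (λ n → length τ < 2 + n) end≡ (≰⇒> no-room)))

corollary3p6 : (μ : List ℕ → List ℕ → ℤ) → IsMobius μ →
    (σ τ : List ℕ) → IsPerm σ → IsPerm τ → σ ≼ τ →
    ((∀ i p → OccAt σ τ i → p < 2 → ¬ Involved σ i p)
     ⊎ (∀ i p → OccAt σ τ i → length τ ∸ 2 ≤ p → p < length τ → ¬ Involved σ i p)) →
    μ σ τ ≡ + 0
corollary3p6 μ isMobius σ τ isσ isτ σ≼τ (inj₁ first-two-free) =
  vanish-first μ isMobius {σ} {τ} (<-wellFounded (length τ)) isσ isτ σ≼τ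
    (first-two-free⇒late {σ} {τ} (proj₁ isσ) first-two-free)
corollary3p6 μ isMobius σ τ isσ isτ σ≼τ (inj₂ last-two-free) =
  vanish-last μ isMobius {σ} {τ} (<-wellFounded (length τ)) isσ isτ σ≼τ
    (last-two-free⇒early {σ} {τ} isσ last-two-free)
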